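{- Let $d\geq 3$. Let $G$ be a $C_4$-free bipartite graph with vertex classes $A$ and $B$. Suppose $A$ has a partition $A_1\cup\dots\cup A_m$ with $|A_i|\leq d^2$ for each $i\in[m]$, and that for all $b\in B$ and $i\in[m]$ we have either $|N(b)\cap A_i|=0$ or $|N(b)\cap A_i|\geq d$. Then $d(G)\leq 18d$.
   Context: $d(G)=2e(G)/|V(G)|$ is the average degree and $N(b)$ is the neighbourhood of $b$. A graph is $C_4$-free if it contains no cycle of length $4$. -}

module Defs where

open import Data.Nat using (ℕ; zero; suc; _+_)
open import Data.Fin using (Fin; zero; suc; _≟_)
open import Data.Bool using (Bool; true; false; _∧_; if_then_else_)
open import Data.Product using (_×_)
open import Relation.Binary.PropositionalEquality using (_≡_; _≢_)
open import Relation.Nullary using (¬_)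
open import Relation.Nullary.Decidable using (⌊_⌋)

record BipGraph (a b : ℕ) : Set where
  field
    adj : Fin a → Fin b → Bool

open BipGraph public

sumFin : ∀ {n} → (Fin n → ℕ) → ℕ
sumFin {zero}  f = 0
sumFin {suc n} f = f zero + sumFin (λ i → f (suc i))

count : ∀ {n} → (Fin n → Bool) → ℕ
count p = sumFin (λ i → if p i then 1 else 0)

edges : ∀ {a b} → BipGraph a b → ℕ
edges G = sumFin (λ x → count (λ y → adj G x y))

C4Free : ∀ {a b} → BipGraph a b → Set
C4Free G = ∀ x₁ x₂ y₁ y₂ → x₁ ≢ x₂ → y₁ ≢ y₂ →
  ¬ (adj G x₁ y₁ ≡ true × adj G x₁ y₂ ≡ true × adj G x₂ y₁ ≡ true × adj G x₂ y₂ ≡ true)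

classSize : ∀ {a m} → (Fin a → Fin m) → Fin m → ℕ
classSize part i = count (λ x → ⌊ part x ≟ i ⌋)

nbhdInClass : ∀ {a b m} → BipGraph a b → (Fin a → Fin m) → Fin b → Fin m → ℕ
nbhdInClass G part y i = count (λ x → ⌊ part x ≟ i ⌋ ∧ adj G x y)

-- Fix a class A_i and write s(y) = |N(y) ∩ A_i|, so E_i = Σ_y s(y) counts the edges at A_i.
-- Two distinct vertices of A_i have at most one common neighbour (G is C₄-free), so counting
-- pairs in A_i with a common neighbour gives Σ_y s(y)² ≤ |A_i|² + E_i, while s(y) ∈ {0} ∪ [d, ∞)
-- gives d E_i ≤ Σ_y s(y)². Hence (d − 1) E_i ≤ |A_i|² ≤ d² |A_i|, which for d ≥ 3 means
-- 2 E_i ≤ 3d |A_i|; summing over the classes, 2e(G) ≤ 3d |A| ≤ 18d (|A| + |B|).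

module Submission where

open import Defs
open import Data.Bool using (Bool; true; false; _∧_; if_then_else_)
open import Data.Bool.Properties using (∧-conicalˡ; ∧-conicalʳ)
open import Data.Empty using (⊥-elim)
open import Data.Fin using (Fin; zero; suc; _≟_)
open import Data.Fin.Properties using (suc-injective)
open import Data.Nat using (ℕ; zero; suc; _+_; _*_; _≤_; z≤n; s≤s)
open import Data.Nat.Properties
  using ( +-*-semiring; *-commutativeSemigroup; +-identityʳ; +-comm; *-identityˡ; *-suc; *-identityʳ; *-zeroʳ
        ; +-mono-≤; +-monoˡ-≤; *-monoˡ-≤; *-monoʳ-≤; +-cancelˡ-≤; *-cancelˡ-≤
        ; m≤m+n; m≤n+m; ≤-trans; ≤-reflexive; module ≤-Reasoning)
open import Data.Nat.Tactic.RingSolver using (solve-∀)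
open import Data.Product using (_,_)
open import Data.Sum using (_⊎_; inj₁; inj₂)
open import Function using (_∘_)
open import Relation.Binary.PropositionalEquality
  using (_≡_; _≢_; refl; sym; trans; cong; cong₂; module ≡-Reasoning)
open import Relation.Nullary using (yes; no)
open import Relation.Nullary.Decidable using (⌊_⌋; ⌊⌋-map′)
open import Algebra.Properties.Semiring.Sum +-*-semiring
  using (sum; sum-syntax; sum-cong-≗; sum-replicate-zero; ∑-comm; ∑-distrib-+; *-distribˡ-sum; *-distribʳ-sum)
open import Algebra.Properties.CommutativeSemigroup *-commutativeSemigroup
  using () renaming (interchange to *-interchange)

𝟙 : Bool → ℕ
𝟙 b = if b then 1 else 0

𝟙-∧ : ∀ p q → 𝟙 (p ∧ q) ≡ 𝟙 p * 𝟙 q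
𝟙-∧ true  q = sym (+-identityʳ (𝟙 q))
𝟙-∧ false q = refl

𝟙-idem : ∀ p → 𝟙 p * 𝟙 p ≡ 𝟙 p
𝟙-idem true  = refl
𝟙-idem false = refl

sumFin≡sum : ∀ {n} (f : Fin n → ℕ) → sumFin f ≡ sum f
sumFin≡sum {zero}  f = refl
sumFin≡sum {suc n} f = cong (f zero +_) (sumFin≡sum (f ∘ suc))

count≡sum : ∀ {n} (p : Fin n → Bool) → count p ≡ sum (𝟙 ∘ p)
count≡sum p = sumFin≡sum (𝟙 ∘ p)

sum-mono-≤ : ∀ {n} {f g : Fin n → ℕ} → (∀ i → f i ≤ g i) → sum f ≤ sum g
sum-mono-≤ {zero}  f≤g = z≤n
sum-mono-≤ {suc n} f≤g = +-mono-≤ (f≤g zero) (sum-mono-≤ (f≤g ∘ suc))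

sum-*-sum : ∀ {m n} (f : Fin m → ℕ) (g : Fin n → ℕ) →
  sum f * sum g ≡ ∑[ i < m ] ∑[ j < n ] (f i * g j)
sum-*-sum f g = trans (*-distribʳ-sum (sum g) f) (sum-cong-≗ (λ i → *-distribˡ-sum (f i) g))

sum-select : ∀ {n} (x : Fin n) (h : Fin n → ℕ) → ∑[ j < n ] (𝟙 ⌊ x ≟ j ⌋ * h j) ≡ h x
sum-select {suc n} zero h =
  trans (cong₂ _+_ (*-identityˡ (h zero)) (sum-replicate-zero n)) (+-identityʳ (h zero))
sum-select {suc n} (suc x) h =
  trans (sum-cong-≗ (λ j → cong (λ b → 𝟙 b * h (suc j)) (⌊⌋-map′ _ _ (x ≟ j))))
        (sum-select x (h ∘ suc))

sum-𝟙-≤1 : ∀ {n} (p : Fin n → Bool) →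
  (∀ {i j} → p i ≡ true → p j ≡ true → i ≡ j) → sum (𝟙 ∘ p) ≤ 1
sum-𝟙-≤1 {zero}  p unique = z≤n
sum-𝟙-≤1 {suc n} p unique with p zero in p₀
... | true  = ≤-reflexive (cong suc (trans (sum-cong-≗ tail≡0) (sum-replicate-zero n)))
  where
  tail≡0 : ∀ j → 𝟙 (p (suc j)) ≡ 0
  tail≡0 j with p (suc j) in pⱼ
  ... | true  with () ← unique p₀ pⱼ
  ... | false = refl
... | false = sum-𝟙-≤1 (p ∘ suc) (λ pᵢ pⱼ → suc-injective (unique pᵢ pⱼ))

∑-1 : ∀ n → ∑[ i < n ] 1 ≡ n
∑-1 zero    = refl
∑-1 (suc n) = cong suc (∑-1 n)

sum-partition : ∀ {a m} (part : Fin a → Fin m) (g : Fin a → ℕ) →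
  ∑[ i < m ] ∑[ x < a ] (𝟙 ⌊ part x ≟ i ⌋ * g x) ≡ sum g
sum-partition part g =
  trans (∑-comm (λ i x → 𝟙 ⌊ part x ≟ i ⌋ * g x)) (sum-cong-≗ (λ x → sum-select (part x) (λ _ → g x)))

sum-classSize : ∀ {a m} (part : Fin a → Fin m) → ∑[ i < m ] classSize part i ≡ a
sum-classSize {a} part = begin
  ∑[ i < _ ] classSize part i                    ≡⟨ sum-cong-≗ classSize≡sum ⟩
  ∑[ i < _ ] ∑[ x < a ] (𝟙 ⌊ part x ≟ i ⌋ * 1)    ≡⟨ sum-partition part (λ _ → 1) ⟩
  ∑[ x < a ] 1                                   ≡⟨ ∑-1 a ⟩
  a                                              ∎
  where
  open ≡-Reasoning
  classSize≡sum : ∀ i → classSize part i ≡ ∑[ x < a ] (𝟙 ⌊ part x ≟ i ⌋ * 1)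
  classSize≡sum i = trans (count≡sum (λ x → ⌊ part x ≟ i ⌋))
                          (sum-cong-≗ (λ x → sym (*-identityʳ (𝟙 ⌊ part x ≟ i ⌋))))

*-sum-≤-∑-square : ∀ {n} d (s : Fin n → ℕ) → (∀ i → s i ≡ 0 ⊎ d ≤ s i) →
  d * sum s ≤ ∑[ i < n ] (s i * s i)
*-sum-≤-∑-square d s gap = ≤-trans (≤-reflexive (*-distribˡ-sum d s)) (sum-mono-≤ pointwise)
  where
  pointwise : ∀ i → d * s i ≤ s i * s i
  pointwise i with gap i
  ... | inj₁ sᵢ≡0 rewrite sᵢ≡0 | *-zeroʳ d = z≤n
  ... | inj₂ d≤sᵢ = *-monoˡ-≤ (s i) d≤sᵢ

d*E≤c*c+E⇒2*E≤3*d*c : ∀ {d E c} → 3 ≤ d → d * E ≤ c * c + E → c ≤ d * d → 2 * E ≤ 3 * d * c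
d*E≤c*c+E⇒2*E≤3*d*c {suc k} {E} {c} (s≤s 2≤k@(s≤s (s≤s z≤n))) dE≤c²+E c≤d² =
  *-cancelˡ-≤ k (begin
    k * (2 * E)          ≡⟨ regroup₁ k E ⟩
    2 * (k * E)          ≤⟨ *-monoʳ-≤ 2 kE≤d²c ⟩
    2 * (d * d * c)      ≡⟨ regroup₂ d c ⟩
    2 * d * (d * c)      ≤⟨ *-monoˡ-≤ (d * c) 2d≤3k ⟩
    3 * k * (d * c)      ≡⟨ regroup₃ k d c ⟩
    k * (3 * d * c)      ∎)
  where
  open ≤-Reasoning
  d : ℕ
  d = suc k
  kE≤d²c : k * E ≤ d * d * c
  kE≤d²c = +-cancelˡ-≤ E (k * E) (d * d * c) (begin
    E + k * E            ≤⟨ dE≤c²+E ⟩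
    c * c + E            ≤⟨ +-monoˡ-≤ E (*-monoˡ-≤ c c≤d²) ⟩
    d * d * c + E        ≡⟨ +-comm (d * d * c) E ⟩
    E + d * d * c        ∎)
  2d≤3k : 2 * d ≤ 3 * k
  2d≤3k = ≤-trans (≤-reflexive (*-suc 2 k)) (+-monoˡ-≤ (2 * k) 2≤k)
  regroup₁ : ∀ k E → k * (2 * E) ≡ 2 * (k * E)
  regroup₁ = solve-∀
  regroup₂ : ∀ d c → 2 * (d * d * c) ≡ 2 * d * (d * c)
  regroup₂ = solve-∀
  regroup₃ : ∀ k d c → 3 * k * (d * c) ≡ k * (3 * d * c)
  regroup₃ = solve-∀

module _ {a b : ℕ} (G : BipGraph a b) where

  deg : Fin a → ℕ
  deg x = ∑[ y < b ] 𝟙 (adj G x y)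

  codeg : Fin a → Fin a → ℕ
  codeg x₁ x₂ = ∑[ y < b ] (𝟙 (adj G x₁ y) * 𝟙 (adj G x₂ y))

  codeg-diag : ∀ x → codeg x x ≡ deg x
  codeg-diag x = sum-cong-≗ (𝟙-idem ∘ adj G x)

  codeg-≤1 : C4Free G → ∀ {x₁ x₂} → x₁ ≢ x₂ → codeg x₁ x₂ ≤ 1
  codeg-≤1 c4 {x₁} {x₂} x₁≢x₂ = begin
    codeg x₁ x₂           ≡⟨ sum-cong-≗ (λ y → 𝟙-∧ (adj G x₁ y) (adj G x₂ y)) ⟨
    sum (𝟙 ∘ common)      ≤⟨ sum-𝟙-≤1 common unique ⟩
    1                     ∎
    where
    open ≤-Reasoning
    common : Fin b → Bool
    common y = adj G x₁ y ∧ adj G x₂ y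
    unique : ∀ {y₁ y₂} → common y₁ ≡ true → common y₂ ≡ true → y₁ ≡ y₂
    unique {y₁} {y₂} e₁ e₂ with y₁ ≟ y₂
    ... | yes y₁≡y₂ = y₁≡y₂
    ... | no  y₁≢y₂ = ⊥-elim (c4 x₁ x₂ y₁ y₂ x₁≢x₂ y₁≢y₂
      (∧-conicalˡ _ _ e₁ , ∧-conicalˡ _ _ e₂ , ∧-conicalʳ _ _ e₁ , ∧-conicalʳ _ _ e₂))

  codeg-≤ : C4Free G → ∀ x₁ x₂ → codeg x₁ x₂ ≤ 1 + 𝟙 ⌊ x₁ ≟ x₂ ⌋ * deg x₁
  codeg-≤ c4 x₁ x₂ with x₁ ≟ x₂
  ... | yes refl = ≤-trans (≤-reflexive (trans (codeg-diag x₁) (sym (+-identityʳ (deg x₁))))) (m≤n+m _ 1)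
  ... | no  x₁≢x₂ = ≤-trans (codeg-≤1 c4 x₁≢x₂) (m≤m+n 1 0)

  nbhdIn : (Fin a → Bool) → Fin b → ℕ
  nbhdIn S y = count (λ x → S x ∧ adj G x y)

  nbhdIn≡sum : ∀ S y → nbhdIn S y ≡ ∑[ x < a ] (𝟙 (S x) * 𝟙 (adj G x y))
  nbhdIn≡sum S y = trans (count≡sum (λ x → S x ∧ adj G x y)) (sum-cong-≗ (λ x → 𝟙-∧ (S x) (adj G x y)))

  sum-nbhdIn : ∀ S → ∑[ y < b ] nbhdIn S y ≡ ∑[ x < a ] (𝟙 (S x) * deg x)
  sum-nbhdIn S = begin
    ∑[ y < b ] nbhdIn S y                               ≡⟨ sum-cong-≗ (nbhdIn≡sum S) ⟩
    ∑[ y < b ] ∑[ x < a ] (𝟙 (S x) * 𝟙 (adj G x y))     ≡⟨ ∑-comm (λ y x → 𝟙 (S x) * 𝟙 (adj G x y)) ⟩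
    ∑[ x < a ] ∑[ y < b ] (𝟙 (S x) * 𝟙 (adj G x y))     ≡⟨ sum-cong-≗ (λ x → *-distribˡ-sum (𝟙 (S x)) (𝟙 ∘ adj G x)) ⟨
    ∑[ x < a ] (𝟙 (S x) * deg x)                        ∎
    where open ≡-Reasoning

  sum-nbhdIn² : ∀ S → ∑[ y < b ] (nbhdIn S y * nbhdIn S y)
                    ≡ ∑[ x₁ < a ] ∑[ x₂ < a ] (𝟙 (S x₁) * 𝟙 (S x₂) * codeg x₁ x₂)
  sum-nbhdIn² S = begin
    ∑[ y < b ] (nbhdIn S y * nbhdIn S y)              ≡⟨ sum-cong-≗ square ⟩
    ∑[ y < b ] ∑[ x₁ < a ] ∑[ x₂ < a ] term y x₁ x₂    ≡⟨ ∑-comm (λ y x₁ → ∑[ x₂ < a ] term y x₁ x₂) ⟩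
    ∑[ x₁ < a ] ∑[ y < b ] ∑[ x₂ < a ] term y x₁ x₂    ≡⟨ sum-cong-≗ (λ x₁ → ∑-comm (λ y x₂ → term y x₁ x₂)) ⟩
    ∑[ x₁ < a ] ∑[ x₂ < a ] ∑[ y < b ] term y x₁ x₂    ≡⟨ sum-cong-≗ (λ x₁ → sum-cong-≗ (pull-out x₁)) ⟩
    ∑[ x₁ < a ] ∑[ x₂ < a ] (𝟙 (S x₁) * 𝟙 (S x₂) * codeg x₁ x₂) ∎
    where
    open ≡-Reasoning
    term : Fin b → Fin a → Fin a → ℕ
    term y x₁ x₂ = 𝟙 (S x₁) * 𝟙 (adj G x₁ y) * (𝟙 (S x₂) * 𝟙 (adj G x₂ y))
    square : ∀ y → nbhdIn S y * nbhdIn S y ≡ ∑[ x₁ < a ] ∑[ x₂ < a ] term y x₁ x₂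
    square y = trans (cong₂ _*_ (nbhdIn≡sum S y) (nbhdIn≡sum S y)) (sum-*-sum q q)
      where
      q : Fin a → ℕ
      q x = 𝟙 (S x) * 𝟙 (adj G x y)
    pull-out : ∀ x₁ x₂ → ∑[ y < b ] term y x₁ x₂ ≡ 𝟙 (S x₁) * 𝟙 (S x₂) * codeg x₁ x₂
    pull-out x₁ x₂ =
      trans (sum-cong-≗ (λ y → *-interchange (𝟙 (S x₁)) (𝟙 (adj G x₁ y)) (𝟙 (S x₂)) (𝟙 (adj G x₂ y))))
            (sym (*-distribˡ-sum (𝟙 (S x₁) * 𝟙 (S x₂)) (λ y → 𝟙 (adj G x₁ y) * 𝟙 (adj G x₂ y))))

  sum-weighted-codeg-≤ : C4Free G → ∀ S →
    ∑[ x₁ < a ] ∑[ x₂ < a ] (𝟙 (S x₁) * 𝟙 (S x₂) * codeg x₁ x₂)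
      ≤ count S * count S + ∑[ x < a ] (𝟙 (S x) * deg x)
  sum-weighted-codeg-≤ c4 S = begin
    ∑[ x₁ < a ] ∑[ x₂ < a ] (p x₁ * p x₂ * codeg x₁ x₂)
      ≤⟨ sum-mono-≤ row-≤ ⟩
    ∑[ x < a ] (p x * count S + p x * deg x)
      ≡⟨ ∑-distrib-+ (λ x → p x * count S) (λ x → p x * deg x) ⟩
    ∑[ x < a ] (p x * count S) + ∑[ x < a ] (p x * deg x)
      ≡⟨ cong (_+ ∑[ x < a ] (p x * deg x)) (*-distribʳ-sum (count S) p) ⟨
    sum p * count S + ∑[ x < a ] (p x * deg x)
      ≡⟨ cong (λ c → c * count S + ∑[ x < a ] (p x * deg x)) (count≡sum S) ⟨
    count S * count S + ∑[ x < a ] (p x * deg x)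
      ∎
    where
    open ≤-Reasoning
    p : Fin a → ℕ
    p = 𝟙 ∘ S
    expand : ∀ m n e g → m * n * (1 + e * g) ≡ m * n + e * (m * n * g)
    expand = solve-∀
    row-≤ : ∀ x₁ → ∑[ x₂ < a ] (p x₁ * p x₂ * codeg x₁ x₂) ≤ p x₁ * count S + p x₁ * deg x₁
    row-≤ x₁ = begin
      ∑[ x₂ < a ] (p₁ * p x₂ * codeg x₁ x₂)
        ≤⟨ sum-mono-≤ (λ x₂ → *-monoʳ-≤ (p₁ * p x₂) (codeg-≤ c4 x₁ x₂)) ⟩
      ∑[ x₂ < a ] (p₁ * p x₂ * (1 + δ x₂ * deg x₁))
        ≡⟨ sum-cong-≗ (λ x₂ → expand p₁ (p x₂) (δ x₂) (deg x₁)) ⟩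
      ∑[ x₂ < a ] (p₁ * p x₂ + δ x₂ * (p₁ * p x₂ * deg x₁))
        ≡⟨ ∑-distrib-+ (λ x₂ → p₁ * p x₂) (λ x₂ → δ x₂ * (p₁ * p x₂ * deg x₁)) ⟩
      ∑[ x₂ < a ] (p₁ * p x₂) + ∑[ x₂ < a ] (δ x₂ * (p₁ * p x₂ * deg x₁))
        ≡⟨ cong₂ _+_ (*-distribˡ-sum p₁ p) (sym (sum-select x₁ (λ x₂ → p₁ * p x₂ * deg x₁))) ⟨
      p₁ * sum p + p₁ * p₁ * deg x₁
        ≡⟨ cong₂ (λ c q → p₁ * c + q * deg x₁) (sym (count≡sum S)) (𝟙-idem (S x₁)) ⟩
      p₁ * count S + p₁ * deg x₁
        ∎
      where
      p₁ : ℕ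
      p₁ = p x₁
      δ : Fin a → ℕ
      δ x₂ = 𝟙 ⌊ x₁ ≟ x₂ ⌋

  sum-nbhdIn²-≤ : C4Free G → ∀ S →
    ∑[ y < b ] (nbhdIn S y * nbhdIn S y) ≤ count S * count S + ∑[ y < b ] nbhdIn S y
  sum-nbhdIn²-≤ c4 S = begin
    ∑[ y < b ] (nbhdIn S y * nbhdIn S y)                           ≡⟨ sum-nbhdIn² S ⟩
    ∑[ x₁ < a ] ∑[ x₂ < a ] (𝟙 (S x₁) * 𝟙 (S x₂) * codeg x₁ x₂)    ≤⟨ sum-weighted-codeg-≤ c4 S ⟩
    count S * count S + ∑[ x < a ] (𝟙 (S x) * deg x)               ≡⟨ cong (count S * count S +_) (sum-nbhdIn S) ⟨
    count S * count S + ∑[ y < b ] nbhdIn S y                      ∎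
    where open ≤-Reasoning

  2*sum-nbhdIn≤3*d*count : ∀ {d} → 3 ≤ d → C4Free G → ∀ S → count S ≤ d * d →
    (∀ y → nbhdIn S y ≡ 0 ⊎ d ≤ nbhdIn S y) → 2 * ∑[ y < b ] nbhdIn S y ≤ 3 * d * count S
  2*sum-nbhdIn≤3*d*count {d} 3≤d c4 S small gap = d*E≤c*c+E⇒2*E≤3*d*c 3≤d
    (≤-trans (*-sum-≤-∑-square d (nbhdIn S) gap) (sum-nbhdIn²-≤ c4 S)) small

  edges≡sum-deg : edges G ≡ sum deg
  edges≡sum-deg = trans (sumFin≡sum (λ x → count (adj G x))) (sum-cong-≗ (λ x → count≡sum (adj G x)))

  sum-nbhdInClass : ∀ {m} (part : Fin a → Fin m) →
    ∑[ i < m ] ∑[ y < b ] nbhdInClass G part y i ≡ edges G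
  sum-nbhdInClass part = begin
    ∑[ i < _ ] ∑[ y < b ] nbhdInClass G part y i          ≡⟨ sum-cong-≗ (λ i → sum-nbhdIn (λ x → ⌊ part x ≟ i ⌋)) ⟩
    ∑[ i < _ ] ∑[ x < a ] (𝟙 ⌊ part x ≟ i ⌋ * deg x)      ≡⟨ sum-partition part deg ⟩
    sum deg                                               ≡⟨ edges≡sum-deg ⟨
    edges G                                               ∎
    where open ≡-Reasoning

lemma4p5 : (d : ℕ) → 3 ≤ d →
    (a b : ℕ) (G : BipGraph a b) → C4Free G →
    (m : ℕ) (part : Fin a → Fin m) →
    (∀ i → classSize part i ≤ d * d) →
    (∀ y i → nbhdInClass G part y i ≡ 0 ⊎ d ≤ nbhdInClass G part y i) →
    2 * edges G ≤ 18 * d * (a + b)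
lemma4p5 d 3≤d a b G c4 m part small gap = begin
  2 * edges G                             ≡⟨ cong (2 *_) (sum-nbhdInClass G part) ⟨
  2 * ∑[ i < m ] e i                      ≡⟨ *-distribˡ-sum 2 e ⟩
  ∑[ i < m ] (2 * e i)                    ≤⟨ sum-mono-≤ per-class ⟩
  ∑[ i < m ] (3 * d * classSize part i)   ≡⟨ *-distribˡ-sum (3 * d) (classSize part) ⟨
  3 * d * ∑[ i < m ] classSize part i     ≡⟨ cong (3 * d *_) (sum-classSize part) ⟩
  3 * d * a                               ≤⟨ *-monoˡ-≤ a (*-monoˡ-≤ d (m≤m+n 3 15)) ⟩
  18 * d * a                              ≤⟨ *-monoʳ-≤ (18 * d) (m≤m+n a b) ⟩
  18 * d * (a + b)                        ∎
  where
  open ≤-Reasoning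
  inClass : Fin m → Fin a → Bool
  inClass i x = ⌊ part x ≟ i ⌋
  e : Fin m → ℕ
  e i = ∑[ y < b ] nbhdInClass G part y i
  per-class : ∀ i → 2 * e i ≤ 3 * d * classSize part i
  per-class i = 2*sum-nbhdIn≤3*d*count G 3≤d c4 (inClass i) (small i) (λ y → gap y i)
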